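{- Let $d,n\in\mathbb{N}$ with $3\leq d\leq n/4$, let $V$ be a set of $n$ vertices, and let $S\subseteq V$ with $|S|\leq n/6$. Let $H$ be a graph with vertex set $S$ and let $F$ be a bipartite graph with bipartition $(S,V\setminus S)$ such that $\Delta(F\cup H)\leq d$. Let $v\in V\setminus S$. Then, writing $G=G_{n,d}$, $$\mathbb{E}[d_{G,S}(v)-d_F(v)\mid G_{n,d}[S]=H,\ F\subseteq G_{n,d}]\leq 6d|S|/n.$$
   Context: $G_{n,d}$ is a uniformly random simple $d$-regular graph on vertex set $V$. $d_F(v)$ is the degree of $v$ in $F$, $d_{G,S}(v)$ is the number of neighbours of $v$ in $G$ that lie in $S$, $\Delta$ denotes maximum degree and $G[S]$ the induced subgraph on $S$. -}

module Defs where

open import Data.Bool using (Bool; true; false; _∧_; _∨_; not; if_then_else_)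
open import Data.Nat using (ℕ; zero; suc; _+_)
open import Data.Fin using (Fin)
open import Data.Vec using (Vec; []; _∷_; lookup)
open import Data.List.Base using (List; []; _∷_; [_]; concatMap; map; allFin; foldr; filterᵇ)
open import Data.Nat.ListAction using (sum)
open import Relation.Binary.PropositionalEquality using (_≡_)

Adj : ℕ → Set
Adj n = Fin n → Fin n → Bool

VSet : ℕ → Set
VSet n = Fin n → Bool

countᵇ : (n : ℕ) → (Fin n → Bool) → ℕ
countᵇ n p = sum (map (λ j → if p j then 1 else 0) (allFin n))

card : {n : ℕ} → VSet n → ℕ
card {n} S = countᵇ n S

deg : {n : ℕ} → Adj n → Fin n → ℕ
deg {n} A v = countᵇ n (λ j → A v j)

degIn : {n : ℕ} → Adj n → VSet n → Fin n → ℕ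
degIn {n} A S v = countᵇ n (λ j → S j ∧ A v j)

_∪ᴳ_ : {n : ℕ} → Adj n → Adj n → Adj n
(A ∪ᴳ B) i j = A i j ∨ B i j

IsSimple : {n : ℕ} → Adj n → Set
IsSimple A = (∀ i j → A i j ≡ A j i) × (∀ i → A i i ≡ false)
  where open import Data.Product using (_×_)

OnVertexSet : {n : ℕ} → VSet n → Adj n → Set
OnVertexSet S H = ∀ i j → H i j ≡ true → (S i ≡ true) Data.Product.× (S j ≡ true)
  where import Data.Product

BipartiteAcross : {n : ℕ} → VSet n → Adj n → Set
BipartiteAcross S F = ∀ i j → F i j ≡ true → S i ≡ not (S j)

MaxDegLe : {n : ℕ} → Adj n → ℕ → Set
MaxDegLe A d = ∀ v → Data.Nat._≤_ (deg A v) d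
  where import Data.Nat

allBoolVecs : (n : ℕ) → List (Vec Bool n)
allBoolVecs zero = [ [] ]
allBoolVecs (suc n) = concatMap (λ v → (true ∷ v) ∷ (false ∷ v) ∷ []) (allBoolVecs n)

allMatrices : (m n : ℕ) → List (Vec (Vec Bool n) m)
allMatrices zero n = [ [] ]
allMatrices (suc m) n =
  concatMap (λ r → map (λ M → r ∷ M) (allMatrices m n)) (allBoolVecs n)

toAdj : {n : ℕ} → Vec (Vec Bool n) n → Adj n
toAdj M i j = lookup (lookup M i) j

-- all adjacency functions Fin n → Fin n → Bool (each exactly once)
allAdj : (n : ℕ) → List (Adj n)
allAdj n = map toAdj (allMatrices n n)

allᵇ : {A : Set} → (A → Bool) → List A → Bool
allᵇ p = foldr (λ x b → p x ∧ b) true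

boolEq : Bool → Bool → Bool
boolEq true b = b
boolEq false b = not b

natEq : ℕ → ℕ → Bool
natEq zero zero = true
natEq zero (suc _) = false
natEq (suc _) zero = false
natEq (suc m) (suc n) = natEq m n

isSimpleᵇ : {n : ℕ} → Adj n → Bool
isSimpleᵇ {n} A =
  allᵇ (λ i → allᵇ (λ j → boolEq (A i j) (A j i)) (allFin n)) (allFin n)
  ∧ allᵇ (λ i → not (A i i)) (allFin n)

isRegularᵇ : {n : ℕ} → ℕ → Adj n → Bool
isRegularᵇ {n} d A = allᵇ (λ v → natEq (deg A v) d) (allFin n)

inducedEqᵇ : {n : ℕ} → VSet n → Adj n → Adj n → Bool
inducedEqᵇ {n} S H G =
  allᵇ (λ i → allᵇ (λ j → not (S i ∧ S j) ∨ boolEq (G i j) (H i j)) (allFin n)) (allFin n)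

subgraphᵇ : {n : ℕ} → Adj n → Adj n → Bool
subgraphᵇ {n} F G =
  allᵇ (λ i → allᵇ (λ j → not (F i j) ∨ G i j) (allFin n)) (allFin n)

-- support of G_{n,d}: all simple d-regular graphs on Fin n (uniform measure)
regularGraphs : (n d : ℕ) → List (Adj n)
regularGraphs n d = filterᵇ (λ G → isSimpleᵇ G ∧ isRegularᵇ d G) (allAdj n)

conditioned : (n d : ℕ) → VSet n → Adj n → Adj n → List (Adj n)
conditioned n d S H F =
  filterᵇ (λ G → inducedEqᵇ S H G ∧ subgraphᵇ F G) (regularGraphs n d)

-- Switching. Call an edge vu of G with u ∈ S and vu ∉ F an excess edge; a graph G in the
-- event has X(G) = d_{G,S}(v) − d_F(v) of them. An excess edge vu and an edge xy with x, y ∉ S,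
-- x ≠ v, vx ∉ G and uy ∉ G can be switched to vx, uy, which keeps G simple, d-regular and
-- in the event. Each excess edge has at least nd − 2(|S|d + d²) ≥ nd/6 such partners xy,
-- whereas every graph in the event has exactly |S|d² triples (u, x, y) with u ∈ S and uy, vx
-- edges, among them the results of switchings. The switching is the translation G ↦ G ⊕ C by
-- the 4-cycle C = v u y x v, hence injective, and double counting gives
-- Σ_G X(G) · nd/6 ≤ |S| d² · #event.

module Submission where

open import Defs
open import Data.Nat using (ℕ; zero; suc; _+_; _*_; _∸_; _≤_; _<_; z≤n; s≤s; >-nonZero)
open import Data.Nat.Properties hiding (_≟_)
open import Data.Nat.Tactic.RingSolver using (solve-∀)
open import Data.Nat.ListAction using (sum)
open import Data.Nat.ListAction.Properties using (sum-++)
open import Algebra.Properties.Semiring.Sum +-*-semiring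
  using (sum-syntax; sum-cong-≗; sum-remove; sum-replicate-zero; ∑-distrib-+; ∑-comm; *-distribˡ-sum; *-distribʳ-sum)
open import Algebra.Properties.CommutativeSemigroup +-commutativeSemigroup
  using (xy∙z≈xz∙y; xy∙z≈zy∙x)
open import Data.Bool using (Bool; true; false; _∧_; _∨_; not; if_then_else_; _xor_)
open import Data.Bool.Properties using (xor-identityʳ; xor-comm; true-xor; ∧-zeroʳ; not-injective)
open import Data.Empty using (⊥; ⊥-elim)
open import Data.Fin using (Fin; zero; suc; _≟_; punchIn)
open import Data.Fin.Properties using (punchInᵢ≢i)
open import Data.List.Base using (List; []; _∷_; _++_; length; map; concatMap; filterᵇ; tabulate; allFin)
open import Data.List.Properties using (map-tabulate; map-++; map-cong; map-∘)
open import Data.Product using (_×_; _,_; proj₁; proj₂)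
open import Data.Product.Function.NonDependent.Propositional using (_×-⇔_)
open import Data.Sum using (_⊎_; inj₁; inj₂; [_,_])
open import Data.Vec as Vec using (Vec; []; _∷_; zipWith; lookup)
open import Data.Vec.Properties using (lookup-zipWith; lookup∘tabulate)
open import Data.Vec.Functional using (updateAt)
open import Data.Vec.Functional.Properties using (updateAt-updates; updateAt-minimal)
open import Function.Base using (_∘_; const)
open import Function.Bundles using (_⇔_; mk⇔; Equivalence)
open import Function.Construct.Composition using (_⇔-∘_)
open import Relation.Binary.PropositionalEquality hiding ([_])
open import Relation.Nullary using (Dec; yes; no; does; ¬_)
open import Relation.Nullary.Decidable using (does-⇔; map′; _×-dec_; _⊎-dec_; dec-true; dec-false)

ind : Bool → ℕ
ind b = if b then 1 else 0

sumOver : {A : Set} → List A → (A → ℕ) → ℕ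
sumOver xs f = sum (map f xs)

module _ {A : Set} where

  sumOver-cong : (xs : List A) {f g : A → ℕ} → (∀ a → f a ≡ g a) → sumOver xs f ≡ sumOver xs g
  sumOver-cong xs f≗g = cong sum (map-cong f≗g xs)

  sumOver-mono-≤ : (xs : List A) {f g : A → ℕ} → (∀ a → f a ≤ g a) → sumOver xs f ≤ sumOver xs g
  sumOver-mono-≤ []       f≤g = z≤n
  sumOver-mono-≤ (x ∷ xs) f≤g = +-mono-≤ (f≤g x) (sumOver-mono-≤ xs f≤g)

  sumOver-*ʳ : (xs : List A) (f : A → ℕ) (c : ℕ) → sumOver xs (λ a → f a * c) ≡ sumOver xs f * c
  sumOver-*ʳ []       f c = refl
  sumOver-*ʳ (x ∷ xs) f c = trans (cong (f x * c +_) (sumOver-*ʳ xs f c)) (sym (*-distribʳ-+ c (f x) _))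

  sumOver-filterᵇ : (xs : List A) (p : A → Bool) (f : A → ℕ) →
                    sumOver (filterᵇ p xs) f ≡ sumOver xs (λ a → ind (p a) * f a)
  sumOver-filterᵇ []       p f = refl
  sumOver-filterᵇ (x ∷ xs) p f with p x
  ... | true  = cong₂ _+_ (sym (+-identityʳ (f x))) (sumOver-filterᵇ xs p f)
  ... | false = sumOver-filterᵇ xs p f

  length≡sumOver-1 : (xs : List A) → length xs ≡ sumOver xs (const 1)
  length≡sumOver-1 []       = refl
  length≡sumOver-1 (x ∷ xs) = cong suc (length≡sumOver-1 xs)

  sumOver-∑ : (xs : List A) {n : ℕ} (f : A → Fin n → ℕ) →
              sumOver xs (λ a → ∑[ j < n ] f a j) ≡ ∑[ j < n ] sumOver xs (λ a → f a j)
  sumOver-∑ []       {n} f = sym (sum-replicate-zero n)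
  sumOver-∑ (x ∷ xs) f = trans (cong (∑[ j < _ ] f x j +_) (sumOver-∑ xs f)) (sym (∑-distrib-+ (f x) _))

sumOver-map : {A B : Set} (xs : List A) (h : A → B) (f : B → ℕ) → sumOver (map h xs) f ≡ sumOver xs (f ∘ h)
sumOver-map xs h f = cong sum (sym (map-∘ xs))

sumOver-concatMap : {A B : Set} (xs : List A) (h : A → List B) (f : B → ℕ) →
                    sumOver (concatMap h xs) f ≡ sumOver xs (λ a → sumOver (h a) f)
sumOver-concatMap []       h f = refl
sumOver-concatMap (x ∷ xs) h f = begin
  sum (map f (h x ++ concatMap h xs))             ≡⟨ cong sum (map-++ f (h x) (concatMap h xs)) ⟩
  sum (map f (h x) ++ map f (concatMap h xs))     ≡⟨ sum-++ (map f (h x)) _ ⟩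
  sumOver (h x) f + sumOver (concatMap h xs) f    ≡⟨ cong (sumOver (h x) f +_) (sumOver-concatMap xs h f) ⟩
  sumOver (h x) f + sumOver xs (λ a → sumOver (h a) f) ∎
  where open ≡-Reasoning

ind-∧ : (a b : Bool) → ind (a ∧ b) ≡ ind a * ind b
ind-∧ true  b = sym (+-identityʳ (ind b))
ind-∧ false b = refl

count≡∑ : (n : ℕ) (p : Fin n → Bool) → countᵇ n p ≡ ∑[ j < n ] ind (p j)
count≡∑ n p = trans (cong sum (map-tabulate (λ j → j) (ind ∘ p))) (sum-tabulate (ind ∘ p))
  where
  sum-tabulate : ∀ {m} (f : Fin m → ℕ) → sum (tabulate f) ≡ ∑[ j < m ] f j
  sum-tabulate {zero}  f = refl
  sum-tabulate {suc m} f = cong (f zero +_) (sum-tabulate (f ∘ suc))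

∑-mono-≤ : {n : ℕ} {f g : Fin n → ℕ} → (∀ j → f j ≤ g j) → ∑[ j < n ] f j ≤ ∑[ j < n ] g j
∑-mono-≤ {zero}  f≤g = z≤n
∑-mono-≤ {suc n} f≤g = +-mono-≤ (f≤g zero) (∑-mono-≤ (f≤g ∘ suc))

term≤∑ : {n : ℕ} (f : Fin n → ℕ) (a : Fin n) → f a ≤ ∑[ j < n ] f j
term≤∑ {suc m} f a = ≤-trans (m≤m+n (f a) _) (≤-reflexive (sym (sum-remove {i = a} f)))

∑-ind-split : {n : ℕ} (p q : Fin n → Bool) →
              ∑[ j < n ] ind (p j) ≡ ∑[ j < n ] ind (p j ∧ q j) + ∑[ j < n ] ind (p j ∧ not (q j))
∑-ind-split p q = trans (sum-cong-≗ split) (∑-distrib-+ (λ j → ind (p j ∧ q j)) _)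
  where
  split : ∀ j → ind (p j) ≡ ind (p j ∧ q j) + ind (p j ∧ not (q j))
  split j with p j | q j
  ... | true  | true  = refl
  ... | true  | false = refl
  ... | false | _     = refl

∑-ind-complement : {n : ℕ} (p : Fin n → Bool) → ∑[ j < n ] ind (not (p j)) + ∑[ j < n ] ind (p j) ≡ n
∑-ind-complement {n} p = trans (sym (∑-distrib-+ (λ j → ind (not (p j))) _)) (go n (λ j → ind (not (p j)) + ind (p j)) (complement ∘ p))
  where
  complement : ∀ b → ind (not b) + ind b ≡ 1
  complement true  = refl
  complement false = refl
  go : ∀ m (f : Fin m → ℕ) → (∀ j → f j ≡ 1) → ∑[ j < m ] f j ≡ m
  go zero    f f≡1 = refl
  go (suc m) f f≡1 = cong₂ _+_ (f≡1 zero) (go m (f ∘ suc) (f≡1 ∘ suc))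

∑-agree-off : {n : ℕ} (f g : Fin n → ℕ) (a : Fin n) → (∀ j → j ≢ a → f j ≡ g j) →
              ∑[ j < n ] f j + g a ≡ ∑[ j < n ] g j + f a
∑-agree-off {suc m} f g a f≡g = begin
  ∑[ j < suc m ] f j + g a   ≡⟨ cong (_+ g a) (sum-remove {i = a} f) ⟩
  f a + rest f + g a         ≡⟨ cong (λ r → f a + r + g a) (sum-cong-≗ (λ k → f≡g _ (punchInᵢ≢i a k))) ⟩
  f a + rest g + g a         ≡⟨ xy∙z≈zy∙x (f a) (rest g) (g a) ⟩
  g a + rest g + f a         ≡⟨ cong (_+ f a) (sum-remove {i = a} g) ⟨
  ∑[ j < suc m ] g j + f a   ∎
  where
  open ≡-Reasoning
  rest : (Fin (suc m) → ℕ) → ℕ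
  rest h = ∑[ k < m ] h (punchIn a k)

∑-agree-off-pair : {n : ℕ} (f g : Fin n → ℕ) {a b : Fin n} → a ≢ b →
                   (∀ j → j ≢ a → j ≢ b → f j ≡ g j) → f a + f b ≡ g a + g b →
                   ∑[ j < n ] f j ≡ ∑[ j < n ] g j
∑-agree-off-pair {n} f g {a} {b} a≢b f≡g fab≡gab = +-cancelʳ-≡ (g a + g b) (∑ f) (∑ g) (begin
  ∑ f + (g a + g b)   ≡⟨ +-assoc (∑ f) (g a) (g b) ⟨
  ∑ f + g a + g b     ≡⟨ cong (λ x → ∑ f + x + g b) (updateAt-updates a f) ⟨
  ∑ f + h a + g b     ≡⟨ cong (_+ g b) (∑-agree-off f h a (λ j j≢a → sym (updateAt-minimal j a f j≢a))) ⟩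
  ∑ h + f a + g b     ≡⟨ xy∙z≈xz∙y (∑ h) (f a) (g b) ⟩
  ∑ h + g b + f a     ≡⟨ cong (_+ f a) (∑-agree-off h g b h≡g) ⟩
  ∑ g + h b + f a     ≡⟨ cong (λ x → ∑ g + x + f a) (updateAt-minimal b a f (a≢b ∘ sym)) ⟩
  ∑ g + f b + f a     ≡⟨ +-assoc (∑ g) (f b) (f a) ⟩
  ∑ g + (f b + f a)   ≡⟨ cong (∑ g +_) (trans (+-comm (f b) (f a)) fab≡gab) ⟩
  ∑ g + (g a + g b)   ∎)
  where
  open ≡-Reasoning
  ∑ : (Fin n → ℕ) → ℕ
  ∑ k = ∑[ j < n ] k j
  h : Fin n → ℕ
  h = updateAt f a (const (g a))
  h≡g : ∀ j → j ≢ b → h j ≡ g j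
  h≡g j j≢b with j ≟ a
  ... | yes refl = updateAt-updates a f
  ... | no  j≢a  = trans (updateAt-minimal j a f j≢a) (f≡g j j≢a j≢b)

∑-ind-≡ : {n : ℕ} (a : Fin n) → ∑[ j < n ] ind (does (j ≟ a)) ≡ 1
∑-ind-≡ {n} a = begin
  ∑[ j < n ] ind (does (j ≟ a))       ≡⟨ +-identityʳ _ ⟨
  ∑[ j < n ] ind (does (j ≟ a)) + 0   ≡⟨ ∑-agree-off (λ j → ind (does (j ≟ a))) (const 0) a elsewhere ⟩
  ∑[ j < n ] 0 + ind (does (a ≟ a))   ≡⟨ cong₂ _+_ (sum-replicate-zero n) (cong ind (dec-true (a ≟ a) refl)) ⟩
  1                                   ∎
  where
  open ≡-Reasoning
  elsewhere : ∀ j → j ≢ a → ind (does (j ≟ a)) ≡ 0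
  elsewhere j j≢a = cong ind (dec-false (j ≟ a) j≢a)

ind-+-not : {x y : Bool} → x ≡ not y → ind x + ind y ≡ ind (not x) + ind (not y)
ind-+-not {y = true}  refl = refl
ind-+-not {y = false} refl = refl

∑∑-distrib-+ : {m n : ℕ} (f g : Fin m → Fin n → ℕ) →
               ∑[ i < m ] ∑[ j < n ] (f i j + g i j) ≡ ∑[ i < m ] ∑[ j < n ] f i j + ∑[ i < m ] ∑[ j < n ] g i j
∑∑-distrib-+ f g = trans (sum-cong-≗ (λ i → ∑-distrib-+ (f i) (g i))) (∑-distrib-+ (λ i → ∑[ j < _ ] f i j) _)

clash : {b : Bool} → b ≡ true → b ≡ false → ⊥
clash refl ()

≢-by : {A : Set} (f : A → Bool) {i j : A} → f i ≡ true → f j ≡ false → i ≢ j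
≢-by f fi fj refl = clash fi fj

∧-true⁻ : {a b : Bool} → a ∧ b ≡ true → a ≡ true × b ≡ true
∧-true⁻ {true} {true} _ = refl , refl

∧-true⁺ : {a b : Bool} → a ≡ true → b ≡ true → a ∧ b ≡ true
∧-true⁺ refl refl = refl

∧-true-⇔ : {a b : Bool} → a ∧ b ≡ true ⇔ (a ≡ true × b ≡ true)
∧-true-⇔ = mk⇔ ∧-true⁻ (λ (p , q) → ∧-true⁺ p q)

not-∨-true-⇔ : {a b : Bool} → not a ∨ b ≡ true ⇔ (a ≡ true → b ≡ true)
not-∨-true-⇔ {true}  = mk⇔ (λ b≡t _ → b≡t) (λ a⇒b → a⇒b refl)
not-∨-true-⇔ {false} = mk⇔ (λ _ ()) (λ _ → refl)

not-true-⇔ : {a : Bool} → not a ≡ true ⇔ a ≡ false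
not-true-⇔ {true}  = mk⇔ (λ ()) (λ ())
not-true-⇔ {false} = mk⇔ (λ _ → refl) (λ _ → refl)

boolEq-⇔ : {a b : Bool} → boolEq a b ≡ true ⇔ a ≡ b
boolEq-⇔ {true}  {true}  = mk⇔ (λ _ → refl) (λ _ → refl)
boolEq-⇔ {true}  {false} = mk⇔ (λ ()) (λ ())
boolEq-⇔ {false} {true}  = mk⇔ (λ ()) (λ ())
boolEq-⇔ {false} {false} = mk⇔ (λ _ → refl) (λ _ → refl)

natEq-⇔ : {m n : ℕ} → natEq m n ≡ true ⇔ m ≡ n
natEq-⇔ {zero}  {zero}  = mk⇔ (λ _ → refl) (λ _ → refl)
natEq-⇔ {zero}  {suc n} = mk⇔ (λ ()) (λ ())
natEq-⇔ {suc m} {zero}  = mk⇔ (λ ()) (λ ())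
natEq-⇔ {suc m} {suc n} = mk⇔ (cong suc ∘ Equivalence.to natEq-⇔) (Equivalence.from (natEq-⇔ {m}) ∘ suc-injective)

allᵇ-tabulate-⇔ : {A : Set} {m : ℕ} (f : Fin m → A) (p : A → Bool) →
                  allᵇ p (tabulate f) ≡ true ⇔ (∀ i → p (f i) ≡ true)
allᵇ-tabulate-⇔ {m = zero}  f p = mk⇔ (λ _ ()) (λ _ → refl)
allᵇ-tabulate-⇔ {m = suc m} f p = mk⇔
  (λ all → let (here , rest) = ∧-true⁻ {p (f zero)} all in
           λ { zero → here ; (suc i) → Equivalence.to (allᵇ-tabulate-⇔ (f ∘ suc) p) rest i })
  (λ all → ∧-true⁺ (all zero) (Equivalence.from (allᵇ-tabulate-⇔ (f ∘ suc) p) (all ∘ suc)))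

allᵇ-allFin-⇔ : {n : ℕ} (p : Fin n → Bool) → allᵇ p (allFin n) ≡ true ⇔ (∀ i → p i ≡ true)
allᵇ-allFin-⇔ = allᵇ-tabulate-⇔ (λ i → i)

private
  ∀-⇔ : {A : Set} {P Q : A → Set} → (∀ x → P x ⇔ Q x) → (∀ x → P x) ⇔ (∀ x → Q x)
  ∀-⇔ P⇔Q = mk⇔ (λ p x → Equivalence.to (P⇔Q x) (p x)) (λ q x → Equivalence.from (P⇔Q x) (q x))

allᵇ²-allFin-⇔ : {n : ℕ} (p : Fin n → Fin n → Bool) →
                 allᵇ (λ i → allᵇ (p i) (allFin n)) (allFin n) ≡ true ⇔ (∀ i j → p i j ≡ true)
allᵇ²-allFin-⇔ p = ∀-⇔ (λ i → allᵇ-allFin-⇔ (p i)) ⇔-∘ allᵇ-allFin-⇔ _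

module _ {n : ℕ} where

  isSimpleᵇ-⇔ : (G : Adj n) → isSimpleᵇ G ≡ true ⇔ IsSimple G
  isSimpleᵇ-⇔ G = (((∀-⇔ λ i → ∀-⇔ λ j → boolEq-⇔) ⇔-∘ allᵇ²-allFin-⇔ _)
                ×-⇔ ((∀-⇔ λ i → not-true-⇔) ⇔-∘ allᵇ-allFin-⇔ _))
                ⇔-∘ ∧-true-⇔

  isRegularᵇ-⇔ : (d : ℕ) (G : Adj n) → isRegularᵇ d G ≡ true ⇔ (∀ w → deg G w ≡ d)
  isRegularᵇ-⇔ d G = (∀-⇔ λ w → natEq-⇔) ⇔-∘ allᵇ-allFin-⇔ _

  inducedEqᵇ-⇔ : (S : VSet n) (H G : Adj n) →
                 inducedEqᵇ S H G ≡ true ⇔ (∀ i j → S i ≡ true → S j ≡ true → G i j ≡ H i j)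
  inducedEqᵇ-⇔ S H G = (∀-⇔ λ i → ∀-⇔ λ j → curried ⇔-∘ not-∨-true-⇔) ⇔-∘ allᵇ²-allFin-⇔ _
    where
    curried : ∀ {i j} → (S i ∧ S j ≡ true → boolEq (G i j) (H i j) ≡ true) ⇔
                        (S i ≡ true → S j ≡ true → G i j ≡ H i j)
    curried = mk⇔ (λ f si sj → Equivalence.to boolEq-⇔ (f (∧-true⁺ si sj)))
                  (λ f sij → let (si , sj) = ∧-true⁻ sij in Equivalence.from boolEq-⇔ (f si sj))

  subgraphᵇ-⇔ : (F G : Adj n) → subgraphᵇ F G ≡ true ⇔ (∀ i j → F i j ≡ true → G i j ≡ true)
  subgraphᵇ-⇔ F G = (∀-⇔ λ i → ∀-⇔ λ j → not-∨-true-⇔) ⇔-∘ allᵇ²-allFin-⇔ _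

-- Translation invariance of the matrix enumeration

_⊕_ : {m n : ℕ} → Vec (Vec Bool n) m → Vec (Vec Bool n) m → Vec (Vec Bool n) m
M ⊕ W = zipWith (zipWith _xor_) M W

toAdj-⊕ : {n : ℕ} (M W : Vec (Vec Bool n) n) (i j : Fin n) → toAdj (M ⊕ W) i j ≡ toAdj M i j xor toAdj W i j
toAdj-⊕ M W i j = trans (cong (λ r → lookup r j) (lookup-zipWith (zipWith _xor_) i M W))
                        (lookup-zipWith _xor_ j (lookup M i) (lookup W i))

sumOver-allBoolVecs-xor : (k : ℕ) (g : Vec Bool k → ℕ) (w : Vec Bool k) →
                          sumOver (allBoolVecs k) (λ r → g (zipWith _xor_ r w)) ≡ sumOver (allBoolVecs k) g
sumOver-allBoolVecs-xor zero    g []      = refl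
sumOver-allBoolVecs-xor (suc k) g (b ∷ w) = begin
  sumOver (allBoolVecs (suc k)) (λ r → g (zipWith _xor_ r (b ∷ w)))
    ≡⟨ sumOver-concatMap (allBoolVecs k) (λ r → (true ∷ r) ∷ (false ∷ r) ∷ []) _ ⟩
  sumOver (allBoolVecs k) (λ r → pair (λ x → g ((x xor b) ∷ zipWith _xor_ r w)))
    ≡⟨ sumOver-allBoolVecs-xor k (λ r → pair (λ x → g ((x xor b) ∷ r))) w ⟩
  sumOver (allBoolVecs k) (λ r → pair (λ x → g ((x xor b) ∷ r)))
    ≡⟨ sumOver-cong (allBoolVecs k) (λ r → pair-xor b (λ x → g (x ∷ r))) ⟩
  sumOver (allBoolVecs k) (λ r → pair (λ x → g (x ∷ r)))
    ≡⟨ sumOver-concatMap (allBoolVecs k) (λ r → (true ∷ r) ∷ (false ∷ r) ∷ []) g ⟨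
  sumOver (allBoolVecs (suc k)) g ∎
  where
  open ≡-Reasoning
  pair : (Bool → ℕ) → ℕ
  pair h = h true + (h false + 0)
  pair-xor : ∀ b h → pair (λ x → h (x xor b)) ≡ pair h
  pair-xor false h = refl
  pair-xor true  h = trans (cong (h false +_) (+-identityʳ (h true)))
                           (trans (+-comm (h false) (h true)) (sym (cong (h true +_) (+-identityʳ (h false)))))

sumOver-allMatrices-⊕ : (m n : ℕ) (g : Vec (Vec Bool n) m → ℕ) (W : Vec (Vec Bool n) m) →
                        sumOver (allMatrices m n) (λ M → g (M ⊕ W)) ≡ sumOver (allMatrices m n) g
sumOver-allMatrices-⊕ zero    n g []      = refl
sumOver-allMatrices-⊕ (suc m) n g (w ∷ W) = begin
  sumOver (allMatrices (suc m) n) (λ M → g (M ⊕ (w ∷ W)))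
    ≡⟨ sumOver-concatMap (allBoolVecs n) rows _ ⟩
  sumOver (allBoolVecs n) (λ r → sumOver (rows r) (λ M → g (M ⊕ (w ∷ W))))
    ≡⟨ sumOver-cong (allBoolVecs n) (λ r → trans (sumOver-map (allMatrices m n) (r ∷_) _)
                                                 (sumOver-allMatrices-⊕ m n (λ M → g (zipWith _xor_ r w ∷ M)) W)) ⟩
  sumOver (allBoolVecs n) (λ r → sumOver (allMatrices m n) (λ M → g (zipWith _xor_ r w ∷ M)))
    ≡⟨ sumOver-allBoolVecs-xor n (λ r → sumOver (allMatrices m n) (λ M → g (r ∷ M))) w ⟩
  sumOver (allBoolVecs n) (λ r → sumOver (allMatrices m n) (λ M → g (r ∷ M)))
    ≡⟨ sumOver-cong (allBoolVecs n) (λ r → sumOver-map (allMatrices m n) (r ∷_) g) ⟨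
  sumOver (allBoolVecs n) (λ r → sumOver (rows r) g)
    ≡⟨ sumOver-concatMap (allBoolVecs n) rows g ⟨
  sumOver (allMatrices (suc m) n) g ∎
  where
  open ≡-Reasoning
  rows : Vec Bool n → List (Vec (Vec Bool n) (suc m))
  rows r = map (r ∷_) (allMatrices m n)

-- Regular graphs

module Regular {n d : ℕ} {G : Adj n} (symmetric : ∀ i j → G i j ≡ G j i)
               (degree : ∀ w → ∑[ j < n ] ind (G w j) ≡ d) where

  ∑-weighted-out-edges : (f : Fin n → ℕ) → ∑[ x < n ] ∑[ y < n ] (f x * ind (G x y)) ≡ (∑[ x < n ] f x) * d
  ∑-weighted-out-edges f = begin
    ∑[ x < n ] ∑[ y < n ] (f x * ind (G x y))   ≡⟨ sum-cong-≗ (λ x → *-distribˡ-sum (f x) (ind ∘ G x)) ⟨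
    ∑[ x < n ] (f x * ∑[ y < n ] ind (G x y))   ≡⟨ sum-cong-≗ (λ x → cong (f x *_) (degree x)) ⟩
    ∑[ x < n ] (f x * d)                       ≡⟨ *-distribʳ-sum d f ⟨
    (∑[ x < n ] f x) * d                      ∎
    where open ≡-Reasoning

  ∑-weighted-in-edges : (f : Fin n → ℕ) → ∑[ x < n ] ∑[ y < n ] (ind (G x y) * f y) ≡ (∑[ y < n ] f y) * d
  ∑-weighted-in-edges f = begin
    ∑[ x < n ] ∑[ y < n ] (ind (G x y) * f y)   ≡⟨ ∑-comm (λ x y → ind (G x y) * f y) ⟩
    ∑[ y < n ] ∑[ x < n ] (ind (G x y) * f y)   ≡⟨ sum-cong-≗ (λ y → sum-cong-≗ (λ x → cong (λ b → ind b * f y) (symmetric x y))) ⟩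
    ∑[ y < n ] ∑[ x < n ] (ind (G y x) * f y)   ≡⟨ sum-cong-≗ (λ y → sum-cong-≗ (λ x → *-comm (ind (G y x)) (f y))) ⟩
    ∑[ y < n ] ∑[ x < n ] (f y * ind (G y x))   ≡⟨ ∑-weighted-out-edges f ⟩
    (∑[ y < n ] f y) * d                      ∎
    where open ≡-Reasoning

-- Switching along a four-cycle

module FourCycle {n : ℕ} (a b c e : Fin n) where

  data Edge : Fin n → Fin n → Set where
    ab : Edge a b
    ba : Edge b a
    bc : Edge b c
    cb : Edge c b
    ce : Edge c e
    ec : Edge e c
    ea : Edge e a
    ae : Edge a e

  Edge-sym : ∀ {i j} → Edge i j → Edge j i
  Edge-sym ab = ba
  Edge-sym ba = ab
  Edge-sym bc = cb
  Edge-sym cb = bc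
  Edge-sym ce = ec
  Edge-sym ec = ce
  Edge-sym ea = ae
  Edge-sym ae = ea

  private
    Pair : Fin n → Fin n → Fin n → Fin n → Set
    Pair i j x y = (i ≡ x × j ≡ y) ⊎ (i ≡ y × j ≡ x)

    pair? : ∀ i j x y → Dec (Pair i j x y)
    pair? i j x y = ((i ≟ x) ×-dec (j ≟ y)) ⊎-dec ((i ≟ y) ×-dec (j ≟ x))

    Edges : Fin n → Fin n → Set
    Edges i j = Pair i j a b ⊎ Pair i j b c ⊎ Pair i j c e ⊎ Pair i j e a

    fromEdges : ∀ {i j} → Edges i j → Edge i j
    fromEdges (inj₁ (inj₁ (refl , refl)))               = ab
    fromEdges (inj₁ (inj₂ (refl , refl)))               = ba
    fromEdges (inj₂ (inj₁ (inj₁ (refl , refl))))        = bc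
    fromEdges (inj₂ (inj₁ (inj₂ (refl , refl))))        = cb
    fromEdges (inj₂ (inj₂ (inj₁ (inj₁ (refl , refl))))) = ce
    fromEdges (inj₂ (inj₂ (inj₁ (inj₂ (refl , refl))))) = ec
    fromEdges (inj₂ (inj₂ (inj₂ (inj₁ (refl , refl))))) = ea
    fromEdges (inj₂ (inj₂ (inj₂ (inj₂ (refl , refl))))) = ae

    toEdges : ∀ {i j} → Edge i j → Edges i j
    toEdges ab = inj₁ (inj₁ (refl , refl))
    toEdges ba = inj₁ (inj₂ (refl , refl))
    toEdges bc = inj₂ (inj₁ (inj₁ (refl , refl)))
    toEdges cb = inj₂ (inj₁ (inj₂ (refl , refl)))
    toEdges ce = inj₂ (inj₂ (inj₁ (inj₁ (refl , refl))))
    toEdges ec = inj₂ (inj₂ (inj₁ (inj₂ (refl , refl))))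
    toEdges ea = inj₂ (inj₂ (inj₂ (inj₁ (refl , refl))))
    toEdges ae = inj₂ (inj₂ (inj₂ (inj₂ (refl , refl))))

  edge? : ∀ i j → Dec (Edge i j)
  edge? i j = map′ fromEdges toEdges
    (pair? i j a b ⊎-dec pair? i j b c ⊎-dec pair? i j c e ⊎-dec pair? i j e a)

  cycle : Adj n
  cycle i j = does (edge? i j)

  cycle-sym : ∀ i j → cycle i j ≡ cycle j i
  cycle-sym i j = does-⇔ (mk⇔ Edge-sym Edge-sym) (edge? i j) (edge? j i)

  module Switch (a≢b : a ≢ b) (b≢c : b ≢ c) (c≢e : c ≢ e) (e≢a : e ≢ a) (a≢c : a ≢ c) (b≢e : b ≢ e)
    {G G' : Adj n} (G-sym : ∀ i j → G i j ≡ G j i)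
    (G-ab : G a b ≡ true) (G-bc : G b c ≡ false) (G-ce : G c e ≡ true) (G-ea : G e a ≡ false)
    (G'≡G⊕cycle : ∀ i j → G' i j ≡ G i j xor cycle i j) where

    off-cycle : ∀ {i j} → ¬ Edge i j → G' i j ≡ G i j
    off-cycle {i} {j} ¬ij =
      trans (G'≡G⊕cycle i j) (trans (cong (G i j xor_) (dec-false (edge? i j) ¬ij)) (xor-identityʳ (G i j)))

    on-cycle : ∀ {i j} → Edge i j → G' i j ≡ not (G i j)
    on-cycle {i} {j} ij =
      trans (G'≡G⊕cycle i j) (trans (cong (G i j xor_) (dec-true (edge? i j) ij)) (trans (xor-comm (G i j) true) (true-xor (G i j))))

    switched-sym : ∀ i j → G' i j ≡ G' j i
    switched-sym i j = trans (G'≡G⊕cycle i j) (trans (cong₂ _xor_ (G-sym i j) (cycle-sym i j)) (sym (G'≡G⊕cycle j i)))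

    switched-loopless : (∀ i → G i i ≡ false) → ∀ i → G' i i ≡ false
    switched-loopless G-loopless i = trans (off-cycle no-loop) (G-loopless i)
      where
      no-loop : ∀ {i} → ¬ Edge i i
      no-loop ab = a≢b refl
      no-loop ba = a≢b refl
      no-loop bc = b≢c refl
      no-loop cb = b≢c refl
      no-loop ce = c≢e refl
      no-loop ec = c≢e refl
      no-loop ea = e≢a refl
      no-loop ae = e≢a refl

    private
      at-a : ∀ {j} → Edge a j → j ≡ b ⊎ j ≡ e
      at-a ab = inj₁ refl
      at-a ae = inj₂ refl
      at-a ba = ⊥-elim (a≢b refl)
      at-a bc = ⊥-elim (a≢b refl)
      at-a cb = ⊥-elim (a≢c refl)
      at-a ce = ⊥-elim (a≢c refl)
      at-a ec = ⊥-elim (e≢a refl)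
      at-a ea = ⊥-elim (e≢a refl)

      at-b : ∀ {j} → Edge b j → j ≡ a ⊎ j ≡ c
      at-b ba = inj₁ refl
      at-b bc = inj₂ refl
      at-b ab = ⊥-elim (a≢b refl)
      at-b ae = ⊥-elim (a≢b refl)
      at-b cb = ⊥-elim (b≢c refl)
      at-b ce = ⊥-elim (b≢c refl)
      at-b ec = ⊥-elim (b≢e refl)
      at-b ea = ⊥-elim (b≢e refl)

      at-c : ∀ {j} → Edge c j → j ≡ b ⊎ j ≡ e
      at-c cb = inj₁ refl
      at-c ce = inj₂ refl
      at-c ab = ⊥-elim (a≢c refl)
      at-c ae = ⊥-elim (a≢c refl)
      at-c ba = ⊥-elim (b≢c refl)
      at-c bc = ⊥-elim (b≢c refl)
      at-c ec = ⊥-elim (c≢e refl)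
      at-c ea = ⊥-elim (c≢e refl)

      at-e : ∀ {j} → Edge e j → j ≡ c ⊎ j ≡ a
      at-e ec = inj₁ refl
      at-e ea = inj₂ refl
      at-e ab = ⊥-elim (e≢a refl)
      at-e ae = ⊥-elim (e≢a refl)
      at-e ba = ⊥-elim (b≢e refl)
      at-e bc = ⊥-elim (b≢e refl)
      at-e cb = ⊥-elim (c≢e refl)
      at-e ce = ⊥-elim (c≢e refl)

      off-vertices : ∀ {w j} → w ≢ a → w ≢ b → w ≢ c → w ≢ e → ¬ Edge w j
      off-vertices w≢a w≢b w≢c w≢e ab = w≢a refl
      off-vertices w≢a w≢b w≢c w≢e ae = w≢a refl
      off-vertices w≢a w≢b w≢c w≢e ba = w≢b refl
      off-vertices w≢a w≢b w≢c w≢e bc = w≢b refl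
      off-vertices w≢a w≢b w≢c w≢e cb = w≢c refl
      off-vertices w≢a w≢b w≢c w≢e ce = w≢c refl
      off-vertices w≢a w≢b w≢c w≢e ec = w≢e refl
      off-vertices w≢a w≢b w≢c w≢e ea = w≢e refl

      -- Along the cycle, G alternates between edges and non-edges, so every
      -- vertex of the cycle loses one neighbour and gains another.
      row-exchange : ∀ {w p q} → p ≢ q → Edge w p → Edge w q → (∀ {j} → Edge w j → j ≡ p ⊎ j ≡ q) →
                     G w p ≡ not (G w q) → ∑[ j < n ] ind (G' w j) ≡ ∑[ j < n ] ind (G w j)
      row-exchange {w} {p} {q} p≢q wp wq only-p-q alternates =
        sym (∑-agree-off-pair (ind ∘ G w) (ind ∘ G' w) p≢q unchanged exchanged)
        where
        unchanged : ∀ j → j ≢ p → j ≢ q → ind (G w j) ≡ ind (G' w j)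
        unchanged j j≢p j≢q = sym (cong ind (off-cycle (λ wj → [ j≢p , j≢q ] (only-p-q wj))))
        exchanged : ind (G w p) + ind (G w q) ≡ ind (G' w p) + ind (G' w q)
        exchanged = trans (ind-+-not alternates) (sym (cong₂ (λ x y → ind x + ind y) (on-cycle wp) (on-cycle wq)))

    switched-degree : ∀ w → ∑[ j < n ] ind (G' w j) ≡ ∑[ j < n ] ind (G w j)
    switched-degree w with w ≟ a | w ≟ b | w ≟ c | w ≟ e
    ... | yes refl | _ | _ | _ = row-exchange b≢e ab ae at-a (trans G-ab (cong not (sym (trans (G-sym a e) G-ea))))
    ... | no _ | yes refl | _ | _ = row-exchange a≢c ba bc at-b (trans (G-sym b a) (trans G-ab (cong not (sym G-bc))))
    ... | no _ | no _ | yes refl | _ = row-exchange b≢e cb ce at-c (trans (G-sym c b) (trans G-bc (cong not (sym G-ce))))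
    ... | no _ | no _ | no _ | yes refl = row-exchange (a≢c ∘ sym) ec ea at-e (trans (G-sym e c) (trans G-ce (cong not (sym G-ea))))
    ... | no w≢a | no w≢b | no w≢c | no w≢e = sum-cong-≗ (λ j → cong ind (off-cycle {w} {j} (off-vertices w≢a w≢b w≢c w≢e)))

nd≤6*slack : ∀ {n d s} → 4 * d ≤ n → 6 * s ≤ n → n * d ≤ 6 * (n * d ∸ 2 * (s * d + d * d))
nd≤6*slack {n} {d} {s} 4d≤n 6s≤n =
  subst (n * d ≤_) (sym (*-distribˡ-∸ 6 (n * d) (2 * (s * d + d * d)))) (m+n≤o⇒m≤o∸n (n * d) bound)
  where
  open ≤-Reasoning
  regroup : ∀ n d s → n * d + 6 * (2 * (s * d + d * d)) ≡ n * d + (2 * (6 * s) + 3 * (4 * d)) * d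
  regroup = solve-∀
  collect : ∀ n d → n * d + (2 * n + 3 * n) * d ≡ 6 * (n * d)
  collect = solve-∀
  bound : n * d + 6 * (2 * (s * d + d * d)) ≤ 6 * (n * d)
  bound = begin
    n * d + 6 * (2 * (s * d + d * d))          ≡⟨ regroup n d s ⟩
    n * d + (2 * (6 * s) + 3 * (4 * d)) * d    ≤⟨ +-monoʳ-≤ (n * d) (*-monoˡ-≤ d (+-mono-≤ (*-monoʳ-≤ 2 6s≤n) (*-monoʳ-≤ 3 4d≤n))) ⟩
    n * d + (2 * n + 3 * n) * d                ≡⟨ collect n d ⟩
    6 * (n * d)                                ∎

cleared-ratio-bound : ∀ {n d s x c} → 0 < d → 4 * d ≤ n → 6 * s ≤ n →
                      x * (n * d ∸ 2 * (s * d + d * d)) ≤ c * (s * d * d) → n * x ≤ 6 * d * s * c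
cleared-ratio-bound {n} {d} {s} {x} {c} 0<d 4d≤n 6s≤n counted = *-cancelˡ-≤ d {{>-nonZero 0<d}} (begin
  d * (n * x)                               ≡⟨ reorder d n x ⟩
  x * (n * d)                               ≤⟨ *-monoʳ-≤ x (nd≤6*slack {s = s} 4d≤n 6s≤n) ⟩
  x * (6 * (n * d ∸ 2 * (s * d + d * d)))   ≡⟨ x*[6*y]≡6*[x*y] x _ ⟩
  6 * (x * (n * d ∸ 2 * (s * d + d * d)))   ≤⟨ *-monoʳ-≤ 6 counted ⟩
  6 * (c * (s * d * d))                     ≡⟨ pull-out-d c s d ⟩
  d * (6 * d * s * c)                       ∎)
  where
  open ≤-Reasoning
  reorder : ∀ d n x → d * (n * x) ≡ x * (n * d)
  reorder = solve-∀
  x*[6*y]≡6*[x*y] : ∀ x y → x * (6 * y) ≡ 6 * (x * y)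
  x*[6*y]≡6*[x*y] = solve-∀
  pull-out-d : ∀ c s d → 6 * (c * (s * d * d)) ≡ d * (6 * d * s * c)
  pull-out-d = solve-∀

-- The switching argument

module Conditioning {n : ℕ} (d : ℕ) (S : VSet n) (H F : Adj n) where

  record InConditioned (G : Adj n) : Set where
    field
      simple   : IsSimple G
      regular  : ∀ w → deg G w ≡ d
      induces  : ∀ i j → S i ≡ true → S j ≡ true → G i j ≡ H i j
      contains : ∀ i j → F i j ≡ true → G i j ≡ true

    symmetric : ∀ i j → G i j ≡ G j i
    symmetric = proj₁ simple

    loopless : ∀ i → G i i ≡ false
    loopless = proj₂ simple

    degree : ∀ w → ∑[ j < n ] ind (G w j) ≡ d
    degree w = trans (sym (count≡∑ n (G w))) (regular w)

  conditionedᵇ : Adj n → Bool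
  conditionedᵇ G = (isSimpleᵇ G ∧ isRegularᵇ d G) ∧ (inducedEqᵇ S H G ∧ subgraphᵇ F G)

  conditionedᵇ-⇔ : (G : Adj n) → conditionedᵇ G ≡ true ⇔ InConditioned G
  conditionedᵇ-⇔ G = mk⇔ to from
    where
    to : conditionedᵇ G ≡ true → InConditioned G
    to c = let (support , event) = ∧-true⁻ {isSimpleᵇ G ∧ isRegularᵇ d G} c
               (s , r) = ∧-true⁻ {isSimpleᵇ G} support
               (i , f) = ∧-true⁻ {inducedEqᵇ S H G} event in
      record { simple   = Equivalence.to (isSimpleᵇ-⇔ G) s
             ; regular  = Equivalence.to (isRegularᵇ-⇔ d G) r
             ; induces  = Equivalence.to (inducedEqᵇ-⇔ S H G) i
             ; contains = Equivalence.to (subgraphᵇ-⇔ F G) f }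
    from : InConditioned G → conditionedᵇ G ≡ true
    from c = ∧-true⁺ (∧-true⁺ (Equivalence.from (isSimpleᵇ-⇔ G) simple) (Equivalence.from (isRegularᵇ-⇔ d G) regular))
                     (∧-true⁺ (Equivalence.from (inducedEqᵇ-⇔ S H G) induces) (Equivalence.from (subgraphᵇ-⇔ F G) contains))
      where open InConditioned c

  eventSum : (Adj n → ℕ) → ℕ
  eventSum f = sumOver (allMatrices n n) (λ M → ind (conditionedᵇ (toAdj M)) * f (toAdj M))

  sumOver-conditioned : (f : Adj n → ℕ) → sumOver (conditioned n d S H F) f ≡ eventSum f
  sumOver-conditioned f = begin
    sumOver (conditioned n d S H F) f
      ≡⟨ sumOver-filterᵇ (regularGraphs n d) inEvent f ⟩
    sumOver (regularGraphs n d) (λ G → ind (inEvent G) * f G)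
      ≡⟨ sumOver-filterᵇ (allAdj n) inSupport _ ⟩
    sumOver (allAdj n) (λ G → ind (inSupport G) * (ind (inEvent G) * f G))
      ≡⟨ sumOver-map (allMatrices n n) toAdj _ ⟩
    sumOver (allMatrices n n) (λ M → ind (inSupport (toAdj M)) * (ind (inEvent (toAdj M)) * f (toAdj M)))
      ≡⟨ sumOver-cong (allMatrices n n) (λ M → ind-∧-* (inSupport (toAdj M)) _ _) ⟩
    eventSum f ∎
    where
    open ≡-Reasoning
    inSupport inEvent : Adj n → Bool
    inSupport G = isSimpleᵇ G ∧ isRegularᵇ d G
    inEvent G = inducedEqᵇ S H G ∧ subgraphᵇ F G
    ind-∧-* : ∀ a b k → ind a * (ind b * k) ≡ ind (a ∧ b) * k
    ind-∧-* true  b k = *-identityˡ (ind b * k)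
    ind-∧-* false b k = refl

  eventSum-mono-≤ : {f g : Adj n → ℕ} → (∀ G → InConditioned G → f G ≤ g G) → eventSum f ≤ eventSum g
  eventSum-mono-≤ {f} {g} f≤g = sumOver-mono-≤ (allMatrices n n) pointwise
    where
    pointwise : ∀ M → ind (conditionedᵇ (toAdj M)) * f (toAdj M) ≤ ind (conditionedᵇ (toAdj M)) * g (toAdj M)
    pointwise M with conditionedᵇ (toAdj M) in M∈event
    ... | false = z≤n
    ... | true  = +-monoˡ-≤ 0 (f≤g (toAdj M) (Equivalence.to (conditionedᵇ-⇔ (toAdj M)) M∈event))

  eventSum-*ʳ : (f : Adj n → ℕ) (c : ℕ) → eventSum (λ G → f G * c) ≡ eventSum f * c
  eventSum-*ʳ f c = trans (sumOver-cong (allMatrices n n) (λ M → sym (*-assoc (ind (conditionedᵇ (toAdj M))) (f (toAdj M)) c)))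
                          (sumOver-*ʳ (allMatrices n n) _ c)

module Switchings {n : ℕ} (d : ℕ) (S : VSet n) (H F : Adj n) (v : Fin n) where

  open Conditioning d S H F

  excessEdge : Adj n → Fin n → Bool
  excessEdge G u = (S u ∧ G v u) ∧ not (F v u)

  partnerEdge : Adj n → Fin n → Fin n → Fin n → Bool
  partnerEdge G u x y = ((not (S x) ∧ G x y) ∧ not (S y)) ∧ not ((G v x ∨ does (x ≟ v)) ∨ G u y)

  forward : Adj n → Fin n → Fin n → Fin n → Bool
  forward G u x y = excessEdge G u ∧ partnerEdge G u x y

  backward : Adj n → Fin n → Fin n → Fin n → Bool
  backward G u x y = (S u ∧ G u y) ∧ G v x

  record Forward (G : Adj n) (u x y : Fin n) : Set where
    field
      u∈S  : S u ≡ true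
      vu∈G : G v u ≡ true
      vu∉F : F v u ≡ false
      x∉S  : S x ≡ false
      xy∈G : G x y ≡ true
      y∉S  : S y ≡ false
      vx∉G : G v x ≡ false
      x≢v  : x ≢ v
      uy∉G : G u y ≡ false

  forward⁻ : ∀ {G u x y} → forward G u x y ≡ true → Forward G u x y
  forward⁻ {G} {u} {x} {y} fwd =
    let (excess , partner)     = ∧-true⁻ {excessEdge G u} fwd
        (u∈S∧vu∈G , vu∉F)      = ∧-true⁻ {S u ∧ G v u} excess
        (u∈S , vu∈G)           = ∧-true⁻ {S u} u∈S∧vu∈G
        (outside , missing)    = ∧-true⁻ {(not (S x) ∧ G x y) ∧ not (S y)} partner
        (x∉S∧xy∈G , y∉S)       = ∧-true⁻ {not (S x) ∧ G x y} outside
        (x∉S , xy∈G)           = ∧-true⁻ {not (S x)} x∉S∧xy∈G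
        (vx∉G∧x≢v , uy∉G)      = ∨-false⁻ {G v x ∨ does (x ≟ v)} (not-true⁻ missing)
        (vx∉G , x≟v-false)     = ∨-false⁻ {G v x} vx∉G∧x≢v
    in record
      { u∈S = u∈S ; vu∈G = vu∈G ; vu∉F = not-true⁻ vu∉F ; x∉S = not-true⁻ x∉S ; xy∈G = xy∈G
      ; y∉S = not-true⁻ y∉S ; vx∉G = vx∉G ; uy∉G = uy∉G
      ; x≢v = does-false⁻ (x ≟ v) x≟v-false }
    where
    not-true⁻ : ∀ {b} → not b ≡ true → b ≡ false
    not-true⁻ = Equivalence.to not-true-⇔
    ∨-false⁻ : ∀ {a b} → a ∨ b ≡ false → a ≡ false × b ≡ false
    ∨-false⁻ {false} {false} _ = refl , refl
    does-false⁻ : ∀ {A : Set} (a? : Dec A) → does a? ≡ false → ¬ A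
    does-false⁻ (no ¬a) _ = ¬a

  cycleAt : Fin n → Fin n → Fin n → Adj n
  cycleAt u x y = FourCycle.cycle v u y x

  -- Switching along the cycle v u y x trades the edges vu, yx of G for uy, xv.
  switch-forward : S v ≡ false → (∀ i j → F i j ≡ F j i) → BipartiteAcross S F →
                   ∀ {G G' u x y} → InConditioned G → forward G u x y ≡ true →
                   (∀ i j → G' i j ≡ G i j xor cycleAt u x y i j) →
                   InConditioned G' × backward G' u x y ≡ true
  switch-forward v∉S F-sym F-bipartite {G} {G'} {u} {x} {y} inG fwd G'≡G⊕cycle = inG' , back
    where
    open InConditioned inG
    open Forward (forward⁻ {G} fwd)
    open FourCycle v u y x
    yx∈G : G y x ≡ true
    yx∈G = trans (symmetric y x) xy∈G
    xv∉G : G x v ≡ false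
    xv∉G = trans (symmetric x v) vx∉G
    open Switch (≢-by S u∈S v∉S ∘ sym) (≢-by S u∈S y∉S) (≢-by (G x) xy∈G (loopless x)) x≢v
                (≢-by (G x) xy∈G xv∉G ∘ sym) (≢-by S u∈S x∉S)
                symmetric vu∈G uy∉G yx∈G xv∉G G'≡G⊕cycle

    inside-S-off-cycle : ∀ {i j} → S i ≡ true → S j ≡ true → ¬ Edge i j
    inside-S-off-cycle i∈S j∈S ab = clash i∈S v∉S
    inside-S-off-cycle i∈S j∈S ba = clash j∈S v∉S
    inside-S-off-cycle i∈S j∈S bc = clash j∈S y∉S
    inside-S-off-cycle i∈S j∈S cb = clash i∈S y∉S
    inside-S-off-cycle i∈S j∈S ce = clash i∈S y∉S
    inside-S-off-cycle i∈S j∈S ec = clash i∈S x∉S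
    inside-S-off-cycle i∈S j∈S ea = clash i∈S x∉S
    inside-S-off-cycle i∈S j∈S ae = clash i∈S v∉S

    contains′ : ∀ i j → F i j ≡ true → G' i j ≡ true
    contains′ i j ij∈F with edge? i j
    ... | no ¬ij  = trans (off-cycle ¬ij) (contains i j ij∈F)
    ... | yes ab = ⊥-elim (clash ij∈F vu∉F)
    ... | yes ba = ⊥-elim (clash (trans (F-sym v u) ij∈F) vu∉F)
    ... | yes bc = trans (on-cycle bc) (cong not uy∉G)
    ... | yes cb = trans (on-cycle cb) (cong not (trans (symmetric y u) uy∉G))
    ... | yes ce = ⊥-elim (clash (trans (F-bipartite y x ij∈F) (cong not x∉S)) y∉S)
    ... | yes ec = ⊥-elim (clash (trans (F-bipartite x y ij∈F) (cong not y∉S)) x∉S)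
    ... | yes ea = trans (on-cycle ea) (cong not xv∉G)
    ... | yes ae = trans (on-cycle ae) (cong not vx∉G)

    inG' : InConditioned G'
    inG' = record
      { simple   = switched-sym , switched-loopless loopless
      ; regular  = λ w → trans (count≡∑ n (G' w)) (trans (switched-degree w) (degree w))
      ; induces  = λ i j i∈S j∈S → trans (off-cycle (inside-S-off-cycle i∈S j∈S)) (induces i j i∈S j∈S)
      ; contains = contains′ }

    back : backward G' u x y ≡ true
    back = ∧-true⁺ (∧-true⁺ u∈S (trans (on-cycle bc) (cong not uy∉G))) (trans (on-cycle ae) (cong not vx∉G))

  s : ℕ
  s = ∑[ j < n ] ind (S j)

  excess : Adj n → ℕ
  excess G = ∑[ u < n ] ind (excessEdge G u)

  excess≡degIn∸deg : S v ≡ false → BipartiteAcross S F → ∀ {G} → InConditioned G →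
                     degIn G S v ∸ deg F v ≡ excess G
  excess≡degIn∸deg v∉S F-bipartite {G} inG = begin
    degIn G S v ∸ deg F v
      ≡⟨ cong₂ _∸_ (trans (count≡∑ n (λ j → S j ∧ G v j)) (∑-ind-split (λ j → S j ∧ G v j) (F v))) (count≡∑ n (F v)) ⟩
    (∑[ j < n ] ind ((S j ∧ G v j) ∧ F v j) + excess G) ∸ ∑[ j < n ] ind (F v j)
      ≡⟨ cong (λ m → (m + excess G) ∸ ∑[ j < n ] ind (F v j)) (sum-cong-≗ forced) ⟩
    (∑[ j < n ] ind (F v j) + excess G) ∸ ∑[ j < n ] ind (F v j)
      ≡⟨ m+n∸m≡n (∑[ j < n ] ind (F v j)) (excess G) ⟩
    excess G ∎
    where
    open ≡-Reasoning
    open InConditioned inG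
    forced : ∀ j → ind ((S j ∧ G v j) ∧ F v j) ≡ ind (F v j)
    forced j with F v j in vj∈F
    ... | false = cong ind (∧-zeroʳ (S j ∧ G v j))
    ... | true  rewrite sym (not-injective (trans (sym v∉S) (F-bipartite v j vj∈F))) | contains v j vj∈F = refl

  partners : Adj n → Fin n → ℕ
  partners G u = ∑[ x < n ] ∑[ y < n ] ind (partnerEdge G u x y)

  lost : ℕ
  lost = 2 * (s * d + d * d)

  outside-closed-neighbourhood-≤ : ∀ {G u} → InConditioned G → S u ≡ true → G v u ≡ true →
                                   ∑[ x < n ] ind (not (S x) ∧ (G v x ∨ does (x ≟ v))) ≤ d
  outside-closed-neighbourhood-≤ {G} {u} inG u∈S vu∈G = begin
    ∑[ x < n ] ind (not (S x) ∧ (G v x ∨ does (x ≟ v)))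
      ≤⟨ ∑-mono-≤ (λ x → neighbour-or-v (S x) (G v x) (does (x ≟ v))) ⟩
    ∑[ x < n ] (ind (G v x ∧ not (S x)) + ind (does (x ≟ v)))
      ≡⟨ ∑-distrib-+ (λ x → ind (G v x ∧ not (S x))) _ ⟩
    ∑[ x < n ] ind (G v x ∧ not (S x)) + ∑[ x < n ] ind (does (x ≟ v))
      ≡⟨ cong (∑[ x < n ] ind (G v x ∧ not (S x)) +_) (∑-ind-≡ v) ⟩
    ∑[ x < n ] ind (G v x ∧ not (S x)) + 1
      ≤⟨ +-monoʳ-≤ (∑[ x < n ] ind (G v x ∧ not (S x))) u-counted ⟩
    ∑[ x < n ] ind (G v x ∧ not (S x)) + ∑[ x < n ] ind (G v x ∧ S x)
      ≡⟨ +-comm (∑[ x < n ] ind (G v x ∧ not (S x))) _ ⟩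
    ∑[ x < n ] ind (G v x ∧ S x) + ∑[ x < n ] ind (G v x ∧ not (S x))
      ≡⟨ ∑-ind-split (G v) S ⟨
    ∑[ x < n ] ind (G v x)
      ≡⟨ InConditioned.degree inG v ⟩
    d ∎
    where
    open ≤-Reasoning
    u-counted : 1 ≤ ∑[ x < n ] ind (G v x ∧ S x)
    u-counted = subst (λ b → ind b ≤ _) (∧-true⁺ vu∈G u∈S) (term≤∑ (λ x → ind (G v x ∧ S x)) u)
    neighbour-or-v : ∀ σ g e → ind (not σ ∧ (g ∨ e)) ≤ ind (g ∧ not σ) + ind e
    neighbour-or-v true  g     e     = z≤n
    neighbour-or-v false true  e     = s≤s z≤n
    neighbour-or-v false false true  = s≤s z≤n
    neighbour-or-v false false false = z≤n

  partners-lower-bound : ∀ {G u} → InConditioned G → S u ≡ true → G v u ≡ true → n * d ≤ lost + partners G u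
  partners-lower-bound {G} {u} inG u∈S vu∈G = begin
    n * d                                                   ≡⟨ cong (_* d) (∑-ind-complement S) ⟨
    (outside + s) * d                                       ≡⟨ *-distribʳ-+ d outside s ⟩
    outside * d + s * d                                     ≡⟨ cong (_+ s * d) (∑-weighted-out-edges (ind ∘ not ∘ S)) ⟨
    ∑[ x < n ] ∑[ y < n ] (ind (not (S x)) * ind (G x y)) + s * d
      ≤⟨ +-monoˡ-≤ (s * d) (∑-mono-≤ (λ x → ∑-mono-≤ (λ y → cover (not (S x)) (G x y) (S y) (near-v x) (G u y)))) ⟩
    ∑[ x < n ] ∑[ y < n ] (into-S x y + ind (partnerEdge G u x y) + via-v x y + via-u x y) + s * d
      ≡⟨ cong (_+ s * d) distribute ⟩
    ∑∑ into-S + partners G u + ∑∑ via-v + ∑∑ via-u + s * d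
      ≤⟨ +-monoˡ-≤ (s * d) (+-mono-≤ (+-mono-≤ (≤-reflexive (cong (_+ partners G u) into-S≡)) via-v≤) (≤-reflexive via-u≡)) ⟩
    s * d + partners G u + d * d + d * d + s * d            ≡⟨ rearrange (s * d) (partners G u) (d * d) ⟩
    lost + partners G u                                     ∎
    where
    open ≤-Reasoning
    open InConditioned inG
    open Regular symmetric degree
    outside : ℕ
    outside = ∑[ x < n ] ind (not (S x))
    near-v : Fin n → Bool
    near-v x = G v x ∨ does (x ≟ v)
    into-S via-v via-u : Fin n → Fin n → ℕ
    into-S x y = ind (G x y) * ind (S y)
    via-v  x y = ind (not (S x) ∧ near-v x) * ind (G x y)
    via-u  x y = ind (G x y) * ind (G u y)
    ∑∑ : (Fin n → Fin n → ℕ) → ℕ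
    ∑∑ f = ∑[ x < n ] ∑[ y < n ] f x y
    -- An edge xy with x ∉ S ends in S, or is a partner of vu, or has x ∈ N[v] or y ∈ N(u).
    cover : ∀ a g σ c e → ind a * ind g ≤ ind g * ind σ + ind (((a ∧ g) ∧ not σ) ∧ not (c ∨ e))
                                          + ind (a ∧ c) * ind g + ind g * ind e
    cover false g     σ     c     e     = z≤n
    cover true  false σ     c     e     = z≤n
    cover true  true  true  c     e     = s≤s z≤n
    cover true  true  false true  e     = s≤s z≤n
    cover true  true  false false true  = s≤s z≤n
    cover true  true  false false false = s≤s z≤n
    distribute : ∑∑ (λ x y → into-S x y + ind (partnerEdge G u x y) + via-v x y + via-u x y)
                 ≡ ∑∑ into-S + partners G u + ∑∑ via-v + ∑∑ via-u
    distribute = trans (∑∑-distrib-+ _ via-u) (cong (_+ ∑∑ via-u)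
                   (trans (∑∑-distrib-+ _ via-v) (cong (_+ ∑∑ via-v) (∑∑-distrib-+ into-S _))))
    into-S≡ : ∑∑ into-S ≡ s * d
    into-S≡ = ∑-weighted-in-edges (ind ∘ S)
    via-v≤ : ∑∑ via-v ≤ d * d
    via-v≤ = begin
      ∑∑ via-v                                         ≡⟨ ∑-weighted-out-edges (λ x → ind (not (S x) ∧ near-v x)) ⟩
      (∑[ x < n ] ind (not (S x) ∧ near-v x)) * d      ≤⟨ *-monoˡ-≤ d (outside-closed-neighbourhood-≤ inG u∈S vu∈G) ⟩
      d * d                                            ∎
    via-u≡ : ∑∑ via-u ≡ d * d
    via-u≡ = trans (∑-weighted-in-edges (ind ∘ G u)) (cong (_* d) (degree u))
    rearrange : ∀ a p b → a + p + b + b + a ≡ 2 * (a + b) + p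
    rearrange = solve-∀

  ∑³ : (Fin n → Fin n → Fin n → ℕ) → ℕ
  ∑³ f = ∑[ u < n ] ∑[ x < n ] ∑[ y < n ] f u x y

  forwards backwards : Adj n → ℕ
  forwards  G = ∑³ (λ u x y → ind (forward G u x y))
  backwards G = ∑³ (λ u x y → ind (backward G u x y))

  forwards-lower-bound : ∀ {G} → InConditioned G → excess G * (n * d ∸ lost) ≤ forwards G
  forwards-lower-bound {G} inG = begin
    excess G * slack                                     ≡⟨ *-distribʳ-sum slack (ind ∘ excessEdge G) ⟩
    ∑[ u < n ] (ind (excessEdge G u) * slack)            ≤⟨ ∑-mono-≤ bound ⟩
    ∑[ u < n ] (ind (excessEdge G u) * partners G u)     ≡⟨ sum-cong-≗ expand ⟩
    forwards G                                           ∎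
    where
    open ≤-Reasoning
    slack : ℕ
    slack = n * d ∸ lost
    bound : ∀ u → ind (excessEdge G u) * slack ≤ ind (excessEdge G u) * partners G u
    bound u with excessEdge G u in vu-excess
    ... | false = z≤n
    ... | true  = let (u∈S , vu∈G) = ∧-true⁻ {S u} (proj₁ (∧-true⁻ {S u ∧ G v u} vu-excess)) in
                  +-monoˡ-≤ 0 (m≤n+o⇒m∸n≤o (n * d) lost (partners-lower-bound inG u∈S vu∈G))
    expand : ∀ u → ind (excessEdge G u) * partners G u ≡ ∑[ x < n ] ∑[ y < n ] ind (forward G u x y)
    expand u = trans (*-distribˡ-sum (ind (excessEdge G u)) (λ x → ∑[ y < n ] ind (partnerEdge G u x y))) (sum-cong-≗ (λ x →
               trans (*-distribˡ-sum (ind (excessEdge G u)) (λ y → ind (partnerEdge G u x y))) (sum-cong-≗ (λ y →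
               sym (ind-∧ (excessEdge G u) (partnerEdge G u x y))))))

  backwards≡ : ∀ {G} → InConditioned G → backwards G ≡ s * d * d
  backwards≡ {G} inG = begin
    ∑³ (λ u x y → ind ((S u ∧ G u y) ∧ G v x))
      ≡⟨ sum-cong-≗ (λ u → sum-cong-≗ (λ x → sum-cong-≗ (λ y → factor (S u) (G u y) (G v x)))) ⟩
    ∑³ (λ u x y → ind (S u) * ind (G v x) * ind (G u y))
      ≡⟨ sum-cong-≗ (λ u → sum-cong-≗ (λ x → *-distribˡ-sum (ind (S u) * ind (G v x)) (ind ∘ G u))) ⟨
    ∑[ u < n ] ∑[ x < n ] (ind (S u) * ind (G v x) * ∑[ y < n ] ind (G u y))
      ≡⟨ sum-cong-≗ (λ u → sum-cong-≗ (λ x → cong (ind (S u) * ind (G v x) *_) (degree u))) ⟩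
    ∑[ u < n ] ∑[ x < n ] (ind (S u) * ind (G v x) * d)
      ≡⟨ sum-cong-≗ (λ u → *-distribʳ-sum d (λ x → ind (S u) * ind (G v x))) ⟨
    ∑[ u < n ] (∑[ x < n ] (ind (S u) * ind (G v x)) * d)
      ≡⟨ sum-cong-≗ (λ u → cong (_* d) (*-distribˡ-sum (ind (S u)) (ind ∘ G v))) ⟨
    ∑[ u < n ] (ind (S u) * ∑[ x < n ] ind (G v x) * d)
      ≡⟨ sum-cong-≗ (λ u → cong (λ k → ind (S u) * k * d) (degree v)) ⟩
    ∑[ u < n ] (ind (S u) * d * d)
      ≡⟨ *-distribʳ-sum d (λ u → ind (S u) * d) ⟨
    ∑[ u < n ] (ind (S u) * d) * d
      ≡⟨ cong (_* d) (*-distribʳ-sum d (ind ∘ S)) ⟨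
    s * d * d ∎
    where
    open ≡-Reasoning
    open InConditioned inG
    factor : ∀ a b e → ind ((a ∧ b) ∧ e) ≡ ind a * ind e * ind b
    factor true  true  true  = refl
    factor true  true  false = refl
    factor true  false true  = refl
    factor true  false false = refl
    factor false b     e     = refl

  cycleMatrix : Fin n → Fin n → Fin n → Vec (Vec Bool n) n
  cycleMatrix u x y = Vec.tabulate (λ i → Vec.tabulate (cycleAt u x y i))

  toAdj-cycleMatrix : ∀ u x y i j → toAdj (cycleMatrix u x y) i j ≡ cycleAt u x y i j
  toAdj-cycleMatrix u x y i j =
    trans (cong (λ r → lookup r j) (lookup∘tabulate (λ i → Vec.tabulate (cycleAt u x y i)) i))
          (lookup∘tabulate (cycleAt u x y i) j)

  eventSum-∑³ : (f : Adj n → Fin n → Fin n → Fin n → ℕ) →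
                eventSum (λ G → ∑³ (f G)) ≡ ∑³ (λ u x y → eventSum (λ G → f G u x y))
  eventSum-∑³ f = begin
    eventSum (λ G → ∑³ (f G))
      ≡⟨ sumOver-cong (allMatrices n n) (λ M → ∑³-*ˡ (weight M) (f (toAdj M))) ⟩
    sumOver (allMatrices n n) (λ M → ∑³ (λ u x y → weight M * f (toAdj M) u x y))
      ≡⟨ sumOver-∑ (allMatrices n n) (λ M u → ∑[ x < n ] ∑[ y < n ] (weight M * f (toAdj M) u x y)) ⟩
    ∑[ u < n ] sumOver (allMatrices n n) (λ M → ∑[ x < n ] ∑[ y < n ] (weight M * f (toAdj M) u x y))
      ≡⟨ sum-cong-≗ (λ u → trans (sumOver-∑ (allMatrices n n) (λ M x → ∑[ y < n ] (weight M * f (toAdj M) u x y)))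
                                 (sum-cong-≗ (λ x → sumOver-∑ (allMatrices n n) (λ M y → weight M * f (toAdj M) u x y)))) ⟩
    ∑³ (λ u x y → eventSum (λ G → f G u x y)) ∎
    where
    open ≡-Reasoning
    weight : Vec (Vec Bool n) n → ℕ
    weight M = ind (conditionedᵇ (toAdj M))
    ∑³-*ˡ : ∀ c g → c * ∑³ g ≡ ∑³ (λ u x y → c * g u x y)
    ∑³-*ˡ c g = trans (*-distribˡ-sum c (λ u → ∑[ x < n ] ∑[ y < n ] g u x y)) (sum-cong-≗ (λ u →
                trans (*-distribˡ-sum c (λ x → ∑[ y < n ] g u x y)) (sum-cong-≗ (λ x → *-distribˡ-sum c (g u x)))))

  -- A forward switching of M is the translation M ↦ M ⊕ cycleMatrix u x y, and translations
  -- permute the enumeration: this is the injectivity of the switching map.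
  eventSum-forwards≤backwards : S v ≡ false → (∀ i j → F i j ≡ F j i) → BipartiteAcross S F →
                                eventSum forwards ≤ eventSum backwards
  eventSum-forwards≤backwards v∉S F-sym F-bipartite = begin
    eventSum forwards
      ≡⟨ eventSum-∑³ (λ G u x y → ind (forward G u x y)) ⟩
    ∑³ (λ u x y → sumOver Ms (λ M → weight M * ind (forward (toAdj M) u x y)))
      ≤⟨ ∑-mono-≤ (λ u → ∑-mono-≤ (λ x → ∑-mono-≤ (λ y → sumOver-mono-≤ Ms (switch u x y)))) ⟩
    ∑³ (λ u x y → sumOver Ms (λ M → weight (M ⊕ cycleMatrix u x y) * ind (backward (toAdj (M ⊕ cycleMatrix u x y)) u x y)))
      ≡⟨ sum-cong-≗ (λ u → sum-cong-≗ (λ x → sum-cong-≗ (λ y →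
           sumOver-allMatrices-⊕ n n (λ M → weight M * ind (backward (toAdj M) u x y)) (cycleMatrix u x y)))) ⟩
    ∑³ (λ u x y → sumOver Ms (λ M → weight M * ind (backward (toAdj M) u x y)))
      ≡⟨ eventSum-∑³ (λ G u x y → ind (backward G u x y)) ⟨
    eventSum backwards ∎
    where
    open ≤-Reasoning
    Ms : List (Vec (Vec Bool n) n)
    Ms = allMatrices n n
    weight : Vec (Vec Bool n) n → ℕ
    weight M = ind (conditionedᵇ (toAdj M))
    both : ∀ {a b} → a ≡ true → b ≡ true → 1 ≤ ind a * ind b
    both refl refl = s≤s z≤n
    switch : ∀ u x y M → weight M * ind (forward (toAdj M) u x y)
                         ≤ weight (M ⊕ cycleMatrix u x y) * ind (backward (toAdj (M ⊕ cycleMatrix u x y)) u x y)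
    switch u x y M with conditionedᵇ (toAdj M) in M∈event | forward (toAdj M) u x y in fwd
    ... | false | _     = z≤n
    ... | true  | false = z≤n
    ... | true  | true  =
      let (inG' , back) = switch-forward v∉S F-sym F-bipartite (Equivalence.to (conditionedᵇ-⇔ _) M∈event) fwd
                            (λ i j → trans (toAdj-⊕ M _ i j) (cong (toAdj M i j xor_) (toAdj-cycleMatrix u x y i j)))
      in both (Equivalence.from (conditionedᵇ-⇔ _) inG') back

  eventSum-excess-bound : S v ≡ false → (∀ i j → F i j ≡ F j i) → BipartiteAcross S F →
                          eventSum (λ G → degIn G S v ∸ deg F v) * (n * d ∸ lost) ≤ eventSum (const 1) * (s * d * d)
  eventSum-excess-bound v∉S F-sym F-bipartite = begin
    eventSum X * (n * d ∸ lost)             ≡⟨ eventSum-*ʳ X (n * d ∸ lost) ⟨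
    eventSum (λ G → X G * (n * d ∸ lost))   ≤⟨ eventSum-mono-≤ (λ G inG → subst (λ k → k * (n * d ∸ lost) ≤ forwards G)
                                                  (sym (excess≡degIn∸deg v∉S F-bipartite inG)) (forwards-lower-bound inG)) ⟩
    eventSum forwards                       ≤⟨ eventSum-forwards≤backwards v∉S F-sym F-bipartite ⟩
    eventSum backwards                      ≤⟨ eventSum-mono-≤ (λ G inG → ≤-reflexive (trans (backwards≡ inG) (sym (*-identityˡ _)))) ⟩
    eventSum (λ _ → 1 * (s * d * d))        ≡⟨ eventSum-*ʳ (const 1) (s * d * d) ⟩
    eventSum (const 1) * (s * d * d)        ∎
    where
    open ≤-Reasoning
    X : Adj n → ℕ
    X G = degIn G S v ∸ deg F v

-- The hypotheses on H and on Δ(F ∪ H) only ensure that the conditioning event is non-empty;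
-- the inequality with the denominator cleared holds without them.
lemma3p2 : (d n : ℕ) → 3 ≤ d → 4 * d ≤ n
    → (S : VSet n) → 6 * card S ≤ n
    → (H : Adj n) → IsSimple H → OnVertexSet S H
    → (F : Adj n) → IsSimple F → BipartiteAcross S F
    → MaxDegLe (F ∪ᴳ H) d
    → (v : Fin n) → S v ≡ false
    → n * sum (map (λ G → degIn G S v ∸ deg F v) (conditioned n d S H F))
      ≤ 6 * d * card S * length (conditioned n d S H F)
lemma3p2 d n 3≤d 4d≤n S 6|S|≤n H _ _ F F-simple F-bipartite _ v v∉S =
  subst₂ _≤_ (cong (n *_) (sym (sumOver-conditioned X)))
             (cong₂ (λ k m → 6 * d * k * m) (sym |S|≡s) (sym event-size))
             (cleared-ratio-bound (≤-trans (s≤s z≤n) 3≤d) 4d≤n (subst (λ k → 6 * k ≤ n) |S|≡s 6|S|≤n)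
                                  (eventSum-excess-bound v∉S (proj₁ F-simple) F-bipartite))
  where
  open Conditioning d S H F
  open Switchings d S H F v
  X : Adj n → ℕ
  X G = degIn G S v ∸ deg F v
  |S|≡s : card S ≡ s
  |S|≡s = count≡∑ n S
  event-size : length (conditioned n d S H F) ≡ eventSum (const 1)
  event-size = trans (length≡sumOver-1 (conditioned n d S H F)) (sumOver-conditioned (const 1))
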